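{- Let $n$ and $l$ be positive integers, let $p_1<p_2<\dots<p_l$ be the first $l$ primes and $q=p_{l+1}$. Let $T=\{t\in[2n]:\gcd(t,p_1p_2\cdots p_l)=1\}$, and for $t\in T$ let $$L(t)=\{t\,p_1^{a_1}\cdots p_l^{a_l}: a_1,\ldots,a_l\ge 0,\ t\,p_1^{a_1}\cdots p_l^{a_l}\le 2n\},$$ partially ordered by divisibility. Let $T^*\subseteq T$, and call a set $A^*$ admissible if $A^*\subseteq(2n/q,2n]$ and $A^*=\bigcup_{t\in T^*}A_t$ where, for each $t\in T^*$, $A_t$ is a maximum-size antichain of $L(t)$. Then every admissible $A^*$ can be extended to an $n$-element primitive set $A$ with $A^*\subseteq A\subseteq(2n/q,2n]$; moreover, such extensions can be chosen so that distinct admissible sets $A^*$ extend to distinct sets $A$.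
   Context: A set of positive integers is primitive if no element of it divides another element of it. An antichain of $L(t)$ is a subset in which no element divides another; a maximum-size antichain is one of largest possible cardinality. -}

module Defs where

open import Data.Nat using (ℕ; zero; suc; _+_; _*_; _^_; _≤_; _<_)
open import Data.Nat.Divisibility using (_∣_)
open import Data.Nat.Primality using (Prime)
open import Data.Nat.Coprimality using (Coprime)
open import Data.Fin using (Fin; toℕ; fromℕ; inject₁) renaming (zero to fzero; suc to fsuc)
open import Data.Fin.Subset using (Subset; _∈_; _⊆_; ∣_∣)
open import Data.Product using (Σ; ∃; _×_)
open import Relation.Binary.PropositionalEquality using (_≡_; _≢_)
open import Relation.Nullary using (¬_)

prodFin : (k : ℕ) → (Fin k → ℕ) → ℕ
prodFin zero    f = 1
prodFin (suc k) f = f fzero * prodFin k (λ i → f (fsuc i))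

-- p : Fin (suc l) → ℕ lists the first l+1 primes p_1 < ... < p_l < p_{l+1} = q
-- (index i here corresponds to p_{i+1} of the paper).
FirstPrimes : (l : ℕ) → (Fin (suc l) → ℕ) → Set
FirstPrimes l p =
  (∀ i → Prime (p i)) ×
  (∀ i j → toℕ i < toℕ j → p i < p j) ×
  (∀ r → Prime r → r ≤ p (fromℕ l) → ∃ λ i → p i ≡ r)

smallP : (l : ℕ) → (Fin (suc l) → ℕ) → Fin l → ℕ
smallP l p i = p (inject₁ i)

bigQ : (l : ℕ) → (Fin (suc l) → ℕ) → ℕ
bigQ l p = p (fromℕ l)

primorial : (l : ℕ) → (Fin (suc l) → ℕ) → ℕ
primorial l p = prodFin l (smallP l p)

-- Subsets of {0, 1, ..., 2n}; element i : Fin (suc (2 * n)) stands for toℕ i.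
Univ : ℕ → ℕ
Univ n = suc (2 * n)

InT : (n l : ℕ) → (Fin (suc l) → ℕ) → Fin (Univ n) → Set
InT n l p t = (1 ≤ toℕ t) × Coprime (toℕ t) (primorial l p)

-- x ∈ L(t) : x = t p_1^{a_1} ... p_l^{a_l} (x ≤ 2n is automatic since x : Fin (2n+1))
InL : (n l : ℕ) → (Fin (suc l) → ℕ) → Fin (Univ n) → Fin (Univ n) → Set
InL n l p t x = Σ (Fin l → ℕ) λ a →
  toℕ x ≡ toℕ t * prodFin l (λ i → smallP l p i ^ a i)

Antichain : (n : ℕ) → Subset (Univ n) → Set
Antichain n S = ∀ x y → x ∈ S → y ∈ S → x ≢ y → ¬ (toℕ x ∣ toℕ y)

Primitive : (n : ℕ) → Subset (Univ n) → Set
Primitive = Antichain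

MaxAntichainL : (n l : ℕ) → (Fin (suc l) → ℕ) → Fin (Univ n) → Subset (Univ n) → Set
MaxAntichainL n l p t S =
  (∀ x → x ∈ S → InL n l p t x) ×
  Antichain n S ×
  (∀ B → (∀ x → x ∈ B → InL n l p t x) → Antichain n B → ∣ B ∣ ≤ ∣ S ∣)

InInterval : (n l : ℕ) → (Fin (suc l) → ℕ) → Subset (Univ n) → Set
InInterval n l p S = ∀ x → x ∈ S → 2 * n < bigQ l p * toℕ x

Admissible : (n l : ℕ) → (Fin (suc l) → ℕ) → Subset (Univ n) → Subset (Univ n) → Set
Admissible n l p Tstar Astar =
  InInterval n l p Astar ×
  Σ (Fin (Univ n) → Subset (Univ n)) λ A →
    (∀ t → t ∈ Tstar → MaxAntichainL n l p t (A t)) ×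
    (∀ x → x ∈ Astar → ∃ λ t → t ∈ Tstar × x ∈ A t) ×
    (∀ t x → t ∈ Tstar → x ∈ A t → x ∈ Astar)

module Submission where

-- Let H = (n, 2n] and extend A* by every y ∈ H divisible by no element of A*.  Doubling
-- x ∈ [1, 2n] until it exceeds n is a map "lift" into H which is injective on antichains,
-- since two numbers with the same lift differ by a power of 2.  It is also onto H from the
-- extension: if y ∈ H is a multiple of w ∈ A_t, then y / w < q (as w > 2n/q) is a product of
-- p₁, …, pₗ, so y ∈ L(t); were y not the lift of an element of A_t, lift(A_t) ∪ {y} would be
-- an antichain of L(t) (every subset of H is one) larger than A_t.  Hence the extension has
-- exactly |H| = n elements.  It determines A*: an element x ∈ A*₁ ∩ L(t) added to A*₂ would
-- make A₂,t ∪ {x} a larger antichain of L(t).  The base t of an element is unique because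
-- t is coprime to p₁⋯pₗ.

open import Defs
open import Data.Bool using (true; false)
open import Data.Empty using (⊥; ⊥-elim)
open import Data.Fin using (Fin; toℕ; fromℕ; fromℕ<; lower₁) renaming (zero to fzero; suc to fsuc)
import Data.Fin.Properties as Fin
open import Data.Fin.Subset using (Subset; _⊆_; ∣_∣; _∈_; _-_; _∪_; ⁅_⁆)
open import Data.Fin.Subset.Properties
  using (_∈?_; p⊆p∪q; q⊆p∪q; x∈p∪q⁻; x∈⁅x⁆; x∈⁅y⁆⇒x≡y; ⊆-antisym; x∈p∧x≢y⇒x∈p-y; x∈p⇒∣p-x∣<∣p∣)
open import Data.List using ([]; _∷_)
open import Data.List.Relation.Unary.All using (All; []; _∷_)
open import Data.Nat
  using (ℕ; zero; suc; _+_; _*_; _∸_; _^_; _≤_; _<_; z≤n; s≤s; s≤s⁻¹; >-nonZero; _<?_; _≟_; nonTrivial⇒n>1)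
open import Data.Nat.Coprimality using (Coprime; coprime-divisor)
open import Data.Nat.Divisibility using (_∣_; divides; _∣?_; ∣-reflexive; ∣-trans; ∣-antisym; ∣1⇒≡1; m∣m*n; n∣m*n)
open import Data.Nat.ListAction using (product)
open import Data.Nat.Primality using (Prime; prime; productOfPrimes≥1; prime⇒nonZero)
open import Data.Nat.Primality.Factorisation using (factorise; PrimeFactorisation)
open import Data.Nat.Properties
open import Data.Product using (Σ; ∃; _×_; _,_; proj₁; proj₂)
open import Data.Sum using (_⊎_; inj₁; inj₂; map₂)
open import Data.Vec using (_∷_; here; there; tabulate)
open import Data.Vec.Properties using (lookup⇒[]=; []=⇒lookup; lookup∘tabulate)
open import Function using (_∘_)
open import Relation.Binary.PropositionalEquality
  using (_≡_; _≢_; refl; sym; trans; cong; cong₂; subst; module ≡-Reasoning)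
open import Relation.Nullary using (¬_; Dec; yes; no; does)
open import Relation.Nullary.Decidable using (_×-dec_; _→-dec_; ¬?)
open import Relation.Unary using (Decidable)
open import Algebra.Properties.CommutativeSemigroup *-commutativeSemigroup using (interchange; x∙yz≈y∙xz)

private variable m : ℕ

select : {P : Fin m → Set} → Decidable P → Subset m
select P? = tabulate (does ∘ P?)

∈-select⁺ : {P : Fin m → Set} (P? : Decidable P) {x : Fin m} → P x → x ∈ select P?
∈-select⁺ P? {x} px = lookup⇒[]= x (select P?) (trans (lookup∘tabulate (does ∘ P?) x) (accept (P? x) px))
  where
  accept : {A : Set} (a? : Dec A) → A → does a? ≡ true
  accept (yes _) _ = refl
  accept (no ¬a) a = ⊥-elim (¬a a)

∈-select⁻ : {P : Fin m → Set} (P? : Decidable P) {x : Fin m} → x ∈ select P? → P x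
∈-select⁻ P? {x} x∈ = witness (P? x) (trans (sym (lookup∘tabulate (does ∘ P?) x)) ([]=⇒lookup x∈))
  where
  witness : {A : Set} (a? : Dec A) → does a? ≡ true → A
  witness (yes a) _ = a
  witness (no _) ()

∣select-<∣ : ∀ m k → ∣ select {m} (λ x → k <? toℕ x) ∣ ≡ m ∸ suc k
∣select-<∣ zero    k       = refl
∣select-<∣ (suc m) zero    = all-true m
  where
  all-true : ∀ m → ∣ tabulate {n = m} (λ _ → true) ∣ ≡ m
  all-true zero    = refl
  all-true (suc m) = cong suc (all-true m)
∣select-<∣ (suc m) (suc k) = ∣select-<∣ m k

hasPreimage? : (f : Fin m → Fin m) (S : Subset m) → Decidable (λ y → ∃ λ x → x ∈ S × f x ≡ y)
hasPreimage? f S y = Fin.any? (λ x → (x ∈? S) ×-dec (f x Fin.≟ y))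

image : (Fin m → Fin m) → Subset m → Subset m
image f S = select (hasPreimage? f S)

∈-image⁺ : (f : Fin m → Fin m) {S : Subset m} {x : Fin m} → x ∈ S → f x ∈ image f S
∈-image⁺ f {S} {x} x∈S = ∈-select⁺ (hasPreimage? f S) (x , x∈S , refl)

∈-image⁻ : (f : Fin m → Fin m) {S : Subset m} {y : Fin m} → y ∈ image f S → ∃ λ x → x ∈ S × f x ≡ y
∈-image⁻ f {S} = ∈-select⁻ (hasPreimage? f S)

enumerate : (S : Subset m) → Fin ∣ S ∣ → Fin m
enumerate (true  ∷ S) fzero    = fzero
enumerate (true  ∷ S) (fsuc i) = fsuc (enumerate S i)
enumerate (false ∷ S) i        = fsuc (enumerate S i)

enumerate-∈ : (S : Subset m) (i : Fin ∣ S ∣) → enumerate S i ∈ S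
enumerate-∈ (true  ∷ S) fzero    = here
enumerate-∈ (true  ∷ S) (fsuc i) = there (enumerate-∈ S i)
enumerate-∈ (false ∷ S) i        = there (enumerate-∈ S i)

position : (S : Subset m) {x : Fin m} → x ∈ S → Fin ∣ S ∣
position (true  ∷ S) here      = fzero
position (true  ∷ S) (there p) = fsuc (position S p)
position (false ∷ S) (there p) = position S p

enumerate-position : (S : Subset m) {x : Fin m} (x∈S : x ∈ S) → enumerate S (position S x∈S) ≡ x
enumerate-position (true  ∷ S) here      = refl
enumerate-position (true  ∷ S) (there p) = cong fsuc (enumerate-position S p)
enumerate-position (false ∷ S) (there p) = cong fsuc (enumerate-position S p)

enumerate-injective : (S : Subset m) {i j : Fin ∣ S ∣} → enumerate S i ≡ enumerate S j → i ≡ j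
enumerate-injective (true  ∷ S) {fzero}  {fzero}  _ = refl
enumerate-injective (true  ∷ S) {fsuc i} {fsuc j} e = cong fsuc (enumerate-injective S (Fin.suc-injective e))
enumerate-injective (false ∷ S)                   e = enumerate-injective S (Fin.suc-injective e)

injection⇒∣p∣≤∣q∣ : (S T : Subset m) (h : ∀ x → x ∈ S → Fin m) →
  (∀ x x∈S → h x x∈S ∈ T) → (∀ x y x∈S y∈S → h x x∈S ≡ h y y∈S → x ≡ y) → ∣ S ∣ ≤ ∣ T ∣
injection⇒∣p∣≤∣q∣ S T h h∈T h-inj = Fin.injective⇒≤ {f = h′} h′-inj
  where
  h′ : Fin ∣ S ∣ → Fin ∣ T ∣
  h′ i = position T (h∈T (enumerate S i) (enumerate-∈ S i))
  h′-inj : ∀ {i j} → h′ i ≡ h′ j → i ≡ j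
  h′-inj {i} {j} e = enumerate-injective S (h-inj _ _ _ _ (begin
    h (enumerate S i) _ ≡⟨ enumerate-position T _ ⟨
    enumerate T (h′ i)  ≡⟨ cong (enumerate T) e ⟩
    enumerate T (h′ j)  ≡⟨ enumerate-position T _ ⟩
    h (enumerate S j) _ ∎))
    where open ≡-Reasoning

injection-missing⇒∣p∣<∣q∣ : (S T : Subset m) (h : Fin m → Fin m) →
  (∀ x → x ∈ S → h x ∈ T) → (∀ x y → x ∈ S → y ∈ S → h x ≡ h y → x ≡ y) →
  ∀ y → y ∈ T → (∀ x → x ∈ S → h x ≢ y) → ∣ S ∣ < ∣ T ∣
injection-missing⇒∣p∣<∣q∣ S T h h∈T h-inj y y∈T y∉h[S] = ≤-<-trans
  (injection⇒∣p∣≤∣q∣ S (T - y) (λ x _ → h x)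
     (λ x x∈S → x∈p∧x≢y⇒x∈p-y (h∈T x x∈S) (y∉h[S] x x∈S)) h-inj)
  (x∈p⇒∣p-x∣<∣p∣ y∈T)

prodFin-cong : ∀ k {f g : Fin k → ℕ} → (∀ i → f i ≡ g i) → prodFin k f ≡ prodFin k g
prodFin-cong zero    f≡g = refl
prodFin-cong (suc k) f≡g = cong₂ _*_ (f≡g fzero) (prodFin-cong k (f≡g ∘ fsuc))

prodFin-distrib-* : ∀ k (f g : Fin k → ℕ) → prodFin k (λ i → f i * g i) ≡ prodFin k f * prodFin k g
prodFin-distrib-* zero    f g = refl
prodFin-distrib-* (suc k) f g = trans
  (cong (f fzero * g fzero *_) (prodFin-distrib-* k (f ∘ fsuc) (g ∘ fsuc)))
  (interchange (f fzero) (g fzero) (prodFin k (f ∘ fsuc)) (prodFin k (g ∘ fsuc)))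

prodFin-1 : ∀ k → prodFin k (λ _ → 1) ≡ 1
prodFin-1 zero    = refl
prodFin-1 (suc k) = trans (+-identityʳ _) (prodFin-1 k)

indicator : ∀ {k} → Fin k → Fin k → ℕ
indicator fzero    fzero    = 1
indicator fzero    (fsuc _) = 0
indicator (fsuc _) fzero    = 0
indicator (fsuc j) (fsuc i) = indicator j i

prodFin-^-indicator : ∀ k (f : Fin k → ℕ) j → prodFin k (λ i → f i ^ indicator j i) ≡ f j
prodFin-^-indicator (suc k) f fzero    =
  trans (cong₂ _*_ (*-identityʳ (f fzero)) (prodFin-1 k)) (*-identityʳ (f fzero))
prodFin-^-indicator (suc k) f (fsuc j) = trans (+-identityʳ _) (prodFin-^-indicator k (f ∘ fsuc) j)

module Smooth {l : ℕ} (sp : Fin l → ℕ) where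

  Smooth : ℕ → Set
  Smooth k = Σ (Fin l → ℕ) λ a → k ≡ prodFin l (λ i → sp i ^ a i)

  smooth-1 : Smooth 1
  smooth-1 = (λ _ → 0) , sym (prodFin-1 l)

  smooth-* : ∀ {j k} → Smooth j → Smooth k → Smooth (j * k)
  smooth-* {j} {k} (a , j≡) (b , k≡) = (λ i → a i + b i) , (begin
    j * k                                                       ≡⟨ cong₂ _*_ j≡ k≡ ⟩
    prodFin l (λ i → sp i ^ a i) * prodFin l (λ i → sp i ^ b i) ≡⟨ prodFin-distrib-* l _ _ ⟨
    prodFin l (λ i → sp i ^ a i * sp i ^ b i)                   ≡⟨ prodFin-cong l (λ i → ^-distribˡ-+-* (sp i) (a i) (b i)) ⟨
    prodFin l (λ i → sp i ^ (a i + b i))                        ∎)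
    where open ≡-Reasoning

  smooth-^ : ∀ {k} e → Smooth k → Smooth (k ^ e)
  smooth-^ zero    _  = smooth-1
  smooth-^ (suc e) sk = smooth-* sk (smooth-^ e sk)

  smooth-generator : ∀ j → Smooth (sp j)
  smooth-generator j = indicator j , sym (prodFin-^-indicator l sp j)

coprime-∣ʳ : ∀ {t a b} → Coprime t a → b ∣ a → Coprime t b
coprime-∣ʳ t⊥a b∣a (d∣t , d∣b) = t⊥a (d∣t , ∣-trans d∣b b∣a)

coprime-*ʳ : ∀ {t a b} → Coprime t a → Coprime t b → Coprime t (a * b)
coprime-*ʳ t⊥a t⊥b (d∣t , d∣ab) =
  t⊥b (d∣t , coprime-divisor (λ (e∣d , e∣a) → t⊥a (∣-trans e∣d d∣t , e∣a)) d∣ab)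

coprime-1ʳ : ∀ {t} → Coprime t 1
coprime-1ʳ (_ , d∣1) = ∣1⇒≡1 d∣1

coprime-^ʳ : ∀ {t a} e → Coprime t a → Coprime t (a ^ e)
coprime-^ʳ zero    _   = coprime-1ʳ
coprime-^ʳ (suc e) t⊥a = coprime-*ʳ t⊥a (coprime-^ʳ e t⊥a)

coprime-prodFin-^ : ∀ {t} k (f a : Fin k → ℕ) → Coprime t (prodFin k f) → Coprime t (prodFin k (λ i → f i ^ a i))
coprime-prodFin-^ zero    f a _   = coprime-1ʳ
coprime-prodFin-^ (suc k) f a t⊥P = coprime-*ʳ
  (coprime-^ʳ (a fzero) (coprime-∣ʳ t⊥P (m∣m*n _)))
  (coprime-prodFin-^ k (f ∘ fsuc) (a ∘ fsuc) (coprime-∣ʳ t⊥P (n∣m*n (f fzero))))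

coprime-cofactor-∣ : ∀ {t t′ s s′} → Coprime t s′ → t * s ≡ t′ * s′ → t ∣ t′
coprime-cofactor-∣ {t} {t′} {s} {s′} t⊥s′ e =
  coprime-divisor t⊥s′ (divides s (trans (*-comm s′ t′) (trans (sym e) (*-comm t s))))

coprime-part-unique : ∀ {l} (sp : Fin l → ℕ) {t t′} (a b : Fin l → ℕ) →
  Coprime t (prodFin l sp) → Coprime t′ (prodFin l sp) →
  t * prodFin l (λ i → sp i ^ a i) ≡ t′ * prodFin l (λ i → sp i ^ b i) → t ≡ t′
coprime-part-unique {l} sp a b t⊥P t′⊥P e = ∣-antisym
  (coprime-cofactor-∣ (coprime-prodFin-^ l sp b t⊥P) e)
  (coprime-cofactor-∣ (coprime-prodFin-^ l sp a t′⊥P) (sym e))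

prime⇒2≤ : ∀ {r} → Prime r → 2 ≤ r
prime⇒2≤ {r} (prime _) = nonTrivial⇒n>1 r

module FirstPrimesFacts (l : ℕ) (p : Fin (suc l) → ℕ) (firstPrimes : FirstPrimes l p) where
  open Smooth (smallP l p) public

  private
    q = bigQ l p
    isPrime = proj₁ firstPrimes
    increasing = proj₁ (proj₂ firstPrimes)
    exhaustive = proj₂ (proj₂ firstPrimes)

  2<q : 1 ≤ l → 2 < q
  2<q 1≤l = ≤-<-trans (prime⇒2≤ (isPrime fzero))
    (increasing fzero (fromℕ l) (subst (0 <_) (sym (Fin.toℕ-fromℕ l)) 1≤l))

  smooth-prime : ∀ {r} → Prime r → r < q → Smooth r
  smooth-prime {r} r-prime r<q with exhaustive r r-prime (<⇒≤ r<q)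
  ... | i , pᵢ≡r with l ≟ toℕ i
  ...   | yes l≡i = ⊥-elim (<-irrefl (trans (sym pᵢ≡r) (cong p i≡l)) r<q)
    where
    i≡l : i ≡ fromℕ l
    i≡l = Fin.toℕ-injective (trans (sym l≡i) (sym (Fin.toℕ-fromℕ l)))
  ...   | no  l≢i = subst Smooth (trans (cong p (Fin.inject₁-lower₁ i l≢i)) pᵢ≡r)
                      (smooth-generator (lower₁ i l≢i))

  smooth-product-of-primes : ∀ {rs} → All Prime rs → product rs < q → Smooth (product rs)
  smooth-product-of-primes {[]}     []                    _  = smooth-1
  smooth-product-of-primes {r ∷ rs} (r-prime ∷ rs-prime) lt =
    smooth-* (smooth-prime r-prime r<q) (smooth-product-of-primes rs-prime rs<q)
    where
    instance _ = prime⇒nonZero r-prime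
    r<q : r < q
    r<q = ≤-<-trans (m≤m*n r (product rs) {{>-nonZero (productOfPrimes≥1 rs-prime)}}) lt
    rs<q : product rs < q
    rs<q = ≤-<-trans (m≤n*m (product rs) r) lt

  smooth-<q : ∀ {k} → 1 ≤ k → k < q → Smooth k
  smooth-<q {suc k} _ k<q = subst Smooth (sym factorisation)
    (smooth-product-of-primes factorsPrime (subst (_< q) factorisation k<q))
    where open PrimeFactorisation (factorise (suc k)) renaming (isFactorisation to factorisation)

doublings : (n fuel x : ℕ) → ℕ
doublings n zero       x = 0
doublings n (suc fuel) x with n <? x
... | yes _ = 0
... | no  _ = suc (doublings n fuel (2 * x))

*2^-suc : ∀ x e → x * 2 ^ suc e ≡ 2 * x * 2 ^ e
*2^-suc x e = trans (sym (*-assoc x 2 (2 ^ e))) (cong (_* 2 ^ e) (*-comm x 2))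

*2^doublings-≤ : ∀ n fuel x → x ≤ 2 * n → x * 2 ^ doublings n fuel x ≤ 2 * n
*2^doublings-≤ n zero       x x≤ = ≤-trans (≤-reflexive (*-identityʳ x)) x≤
*2^doublings-≤ n (suc fuel) x x≤ with n <? x
... | yes _   = ≤-trans (≤-reflexive (*-identityʳ x)) x≤
... | no  x≤n = ≤-trans (≤-reflexive (*2^-suc x (doublings n fuel (2 * x))))
                        (*2^doublings-≤ n fuel (2 * x) (*-monoʳ-≤ 2 (≮⇒≥ x≤n)))

<*2^doublings : ∀ n fuel x → 1 ≤ x → n < fuel + x → n < x * 2 ^ doublings n fuel x
<*2^doublings n zero       x _   n< = ≤-trans n< (≤-reflexive (sym (*-identityʳ x)))
<*2^doublings n (suc fuel) x 1≤x n< with n <? x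
... | yes n<x = ≤-trans n<x (≤-reflexive (sym (*-identityʳ x)))
... | no  _   = ≤-trans (<*2^doublings n fuel (2 * x) (≤-trans 1≤x (m≤m+n x _)) n<′)
                        (≤-reflexive (sym (*2^-suc x (doublings n fuel (2 * x)))))
  where
  n<′ : n < fuel + 2 * x
  n<′ = begin-strict
    n              <⟨ n< ⟩
    suc fuel + x   ≡⟨ +-suc fuel x ⟨
    fuel + suc x   ≤⟨ +-monoʳ-≤ fuel (+-monoˡ-≤ x 1≤x) ⟩
    fuel + (x + x) ≡⟨ cong (λ y → fuel + (x + y)) (+-identityʳ x) ⟨
    fuel + 2 * x   ∎
    where open ≤-Reasoning

doublings-large : ∀ n fuel x → n < x → doublings n fuel x ≡ 0
doublings-large n zero       x _   = refl
doublings-large n (suc fuel) x n<x with n <? x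
... | yes _   = refl
... | no  x≤n = ⊥-elim (x≤n n<x)

*2^-cancel-∣ : ∀ {x y a b} → a ≤ b → x * 2 ^ a ≡ y * 2 ^ b → y ∣ x
*2^-cancel-∣ {x} {y} {a} a≤b e with m≤n⇒∃[o]m+o≡n a≤b
... | c , refl = divides (2 ^ c) (*-cancelʳ-≡ x (2 ^ c * y) (2 ^ a) {{m^n≢0 2 a}} (begin
  x * 2 ^ a           ≡⟨ e ⟩
  y * 2 ^ (a + c)     ≡⟨ cong (y *_) (trans (^-distribˡ-+-* 2 a c) (*-comm (2 ^ a) (2 ^ c))) ⟩
  y * (2 ^ c * 2 ^ a) ≡⟨ *-assoc y (2 ^ c) (2 ^ a) ⟨
  y * 2 ^ c * 2 ^ a   ≡⟨ cong (_* 2 ^ a) (*-comm y (2 ^ c)) ⟩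
  2 ^ c * y * 2 ^ a   ∎))
  where open ≡-Reasoning

*2^-comparable : ∀ {x y} a b → x * 2 ^ a ≡ y * 2 ^ b → (x ∣ y) ⊎ (y ∣ x)
*2^-comparable a b e with ≤-total a b
... | inj₁ a≤b = inj₂ (*2^-cancel-∣ a≤b e)
... | inj₂ b≤a = inj₁ (*2^-cancel-∣ b≤a (sym e))

upper-divisor-≡ : ∀ {n x y} → n < x → 1 ≤ y → y ≤ 2 * n → x ∣ y → x ≡ y
upper-divisor-≡ _ 1≤y _ (divides zero refl) = ⊥-elim (<-irrefl refl 1≤y)
upper-divisor-≡ {x = x} _ _ _ (divides 1 refl) = sym (+-identityʳ x)
upper-divisor-≡ {n} {x} n<x _ y≤2n (divides (suc (suc k)) refl) = ⊥-elim (<⇒≱ (*-monoʳ-< 2 n<x) (begin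
  2 * x           ≤⟨ *-monoˡ-≤ x {2} {suc (suc k)} (s≤s (s≤s z≤n)) ⟩
  suc (suc k) * x ≤⟨ y≤2n ⟩
  2 * n           ∎))
  where open ≤-Reasoning

antichain-∪-⁅⁆ : ∀ {n S y} → Antichain n S → (∀ w → w ∈ S → ¬ (toℕ w ∣ toℕ y)) →
  (∀ w → w ∈ S → ¬ (toℕ y ∣ toℕ w)) → Antichain n (S ∪ ⁅ y ⁆)
antichain-∪-⁅⁆ {S = S} {y} anti ¬w∣y ¬y∣w a b a∈ b∈ a≢b a∣b with x∈p∪q⁻ S ⁅ y ⁆ a∈ | x∈p∪q⁻ S ⁅ y ⁆ b∈
... | inj₁ a∈S | inj₁ b∈S = anti a b a∈S b∈S a≢b a∣b
... | inj₁ a∈S | inj₂ b∈y = ¬w∣y a a∈S (subst (λ z → toℕ a ∣ toℕ z) (x∈⁅y⁆⇒x≡y y b∈y) a∣b)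
... | inj₂ a∈y | inj₁ b∈S = ¬y∣w b b∈S (subst (λ z → toℕ z ∣ toℕ b) (x∈⁅y⁆⇒x≡y y a∈y) a∣b)
... | inj₂ a∈y | inj₂ b∈y = a≢b (trans (x∈⁅y⁆⇒x≡y y a∈y) (sym (x∈⁅y⁆⇒x≡y y b∈y)))

module Extension (n l : ℕ) (1≤l : 1 ≤ l) (p : Fin (suc l) → ℕ) (firstPrimes : FirstPrimes l p)
                 (Tstar : Subset (Univ n)) (Tstar⊆T : ∀ t → t ∈ Tstar → InT n l p t) where

  open FirstPrimesFacts l p firstPrimes

  private
    U = Univ n
    q = bigQ l p

  ≤2n : (x : Fin U) → toℕ x ≤ 2 * n
  ≤2n x = s≤s⁻¹ (Fin.toℕ<n x)

  interval⇒1≤ : ∀ {x} → 2 * n < q * x → 1 ≤ x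
  interval⇒1≤ {zero}  2n<q*0 = ⊥-elim (<⇒≱ 2n<q*0 (≤-trans (≤-reflexive (*-zeroʳ q)) z≤n))
  interval⇒1≤ {suc _} _      = s≤s z≤n

  Upper : Subset U
  Upper = select (λ x → n <? toℕ x)

  ∣Upper∣≡n : ∣ Upper ∣ ≡ n
  ∣Upper∣≡n = trans (∣select-<∣ U n) (trans (m+n∸m≡n n (n + 0)) (+-identityʳ n))

  upper-antichain : ∀ S → (∀ x → x ∈ S → n < toℕ x) → Antichain n S
  upper-antichain S upper x y x∈ y∈ x≢y x∣y =
    x≢y (Fin.toℕ-injective (upper-divisor-≡ (upper x x∈) (≤-trans (s≤s z≤n) (upper y y∈)) (≤2n y) x∣y))

  lift : Fin U → Fin U
  lift x = fromℕ< (s≤s (*2^doublings-≤ n n (toℕ x) (≤2n x)))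

  toℕ-lift : ∀ x → toℕ (lift x) ≡ toℕ x * 2 ^ doublings n n (toℕ x)
  toℕ-lift x = Fin.toℕ-fromℕ< _

  lift-upper : ∀ x → 1 ≤ toℕ x → n < toℕ (lift x)
  lift-upper x 1≤x = subst (n <_) (sym (toℕ-lift x)) (<*2^doublings n n (toℕ x) 1≤x (m<m+n n 1≤x))

  lift-fixes-upper : ∀ x → n < toℕ x → lift x ≡ x
  lift-fixes-upper x n<x = Fin.toℕ-injective (begin
    toℕ (lift x)                      ≡⟨ toℕ-lift x ⟩
    toℕ x * 2 ^ doublings n n (toℕ x) ≡⟨ cong (λ e → toℕ x * 2 ^ e) (doublings-large n n (toℕ x) n<x) ⟩
    toℕ x * 1                         ≡⟨ *-identityʳ (toℕ x) ⟩
    toℕ x                             ∎)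
    where open ≡-Reasoning

  lift-injective-on-antichain : ∀ {S} → Antichain n S → ∀ x y → x ∈ S → y ∈ S → lift x ≡ lift y → x ≡ y
  lift-injective-on-antichain anti x y x∈ y∈ e with x Fin.≟ y
  ... | yes x≡y = x≡y
  ... | no  x≢y with *2^-comparable (doublings n n (toℕ x)) (doublings n n (toℕ y))
                         (trans (sym (toℕ-lift x)) (trans (cong toℕ e) (toℕ-lift y)))
  ...   | inj₁ x∣y = ⊥-elim (anti x y x∈ y∈ x≢y x∣y)
  ...   | inj₂ y∣x = ⊥-elim (anti y x y∈ x∈ (x≢y ∘ sym) y∣x)

  InL-*-smooth : ∀ {t x y k} → InL n l p t x → Smooth k → toℕ y ≡ k * toℕ x → InL n l p t y
  InL-*-smooth {t} {x} {y} {k} (a , x≡) smooth-k y≡ with smooth-* smooth-k (a , refl)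
  ... | c , kP≡ = c , (begin
    toℕ y           ≡⟨ y≡ ⟩
    k * toℕ x       ≡⟨ cong (k *_) x≡ ⟩
    k * (toℕ t * P) ≡⟨ x∙yz≈y∙xz k (toℕ t) P ⟩
    toℕ t * (k * P) ≡⟨ cong (toℕ t *_) kP≡ ⟩
    toℕ t * prodFin l (λ i → smallP l p i ^ c i) ∎)
    where
    open ≡-Reasoning
    P = prodFin l (λ i → smallP l p i ^ a i)

  InL-multiple : ∀ {t x y} → InL n l p t x → 2 * n < q * toℕ x → 1 ≤ toℕ y → toℕ x ∣ toℕ y → InL n l p t y
  InL-multiple {t} {x} {y} x∈L x-interval 1≤y (divides k y≡) =
    InL-*-smooth {t} {x} {y} x∈L (smooth-<q 1≤k k<q) y≡
    where
    1≤k : 1 ≤ k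
    1≤k = n≢0⇒n>0 (λ k≡0 → <⇒≱ 1≤y (≤-reflexive (trans y≡ (cong (_* toℕ x) k≡0))))
    k<q : k < q
    k<q = *-cancelʳ-< (toℕ x) k q (≤-<-trans (≤-trans (≤-reflexive (sym y≡)) (≤2n y)) x-interval)

  InL-lift : ∀ {t x} → InL n l p t x → InL n l p t (lift x)
  InL-lift {t} {x} x∈L =
    InL-*-smooth {t} {x} {lift x} x∈L (smooth-^ (doublings n n (toℕ x)) (smooth-<q (s≤s z≤n) (2<q 1≤l)))
      (trans (toℕ-lift x) (*-comm (toℕ x) _))

  InL-base-unique : ∀ {t t′ x} → t ∈ Tstar → t′ ∈ Tstar → InL n l p t x → InL n l p t′ x → t ≡ t′
  InL-base-unique {t} {t′} t∈ t′∈ (a , x≡) (b , x≡′) = Fin.toℕ-injective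
    (coprime-part-unique (smallP l p) a b (proj₂ (Tstar⊆T t t∈)) (proj₂ (Tstar⊆T t′ t′∈))
      (trans (sym x≡) x≡′))

  maximum⇒¬injection-missing : ∀ {t S B y} (h : Fin U → Fin U) → MaxAntichainL n l p t S →
    (∀ x → x ∈ B → InL n l p t x) → Antichain n B →
    (∀ x → x ∈ S → h x ∈ B) → (∀ x x′ → x ∈ S → x′ ∈ S → h x ≡ h x′ → x ≡ x′) →
    y ∈ B → (∀ x → x ∈ S → h x ≢ y) → ⊥
  maximum⇒¬injection-missing {S = S} {B} {y} h (_ , _ , maximum) B⊆L B-antichain h∈B h-inj y∈B y∉h[S] =
    <⇒≱ (injection-missing⇒∣p∣<∣q∣ S B h h∈B h-inj y y∈B y∉h[S]) (maximum B B⊆L B-antichain)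

  Free : Subset U → Fin U → Set
  Free S y = n < toℕ y × (∀ w → w ∈ S → ¬ (toℕ w ∣ toℕ y))

  free? : ∀ S → Decidable (Free S)
  free? S y = (n <? toℕ y) ×-dec Fin.all? (λ w → (w ∈? S) →-dec ¬? (toℕ w ∣? toℕ y))

  extend : Subset U → Subset U
  extend S = S ∪ select (free? S)

  ∈-extend⁻ : ∀ S {x} → x ∈ extend S → x ∈ S ⊎ Free S x
  ∈-extend⁻ S x∈ = map₂ (∈-select⁻ (free? S)) (x∈p∪q⁻ S _ x∈)

  free⇒∈extend : ∀ S {x} → Free S x → x ∈ extend S
  free⇒∈extend S free = q⊆p∪q S _ (∈-select⁺ (free? S) free)

  module AdmissibleExtension {Astar : Subset U} (adm : Admissible n l p Tstar Astar) where

    interval : InInterval n l p Astar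
    interval = proj₁ adm

    part : Fin U → Subset U
    part = proj₁ (proj₂ adm)

    part-maximum : ∀ t → t ∈ Tstar → MaxAntichainL n l p t (part t)
    part-maximum = proj₁ (proj₂ (proj₂ adm))

    covered : ∀ x → x ∈ Astar → ∃ λ t → t ∈ Tstar × x ∈ part t
    covered = proj₁ (proj₂ (proj₂ (proj₂ adm)))

    part⊆ : ∀ t x → t ∈ Tstar → x ∈ part t → x ∈ Astar
    part⊆ = proj₂ (proj₂ (proj₂ (proj₂ adm)))

    part-InL : ∀ {t x} → t ∈ Tstar → x ∈ part t → InL n l p t x
    part-InL {t} {x} t∈ x∈ = proj₁ (part-maximum t t∈) x x∈

    1≤A* : ∀ x → x ∈ Astar → 1 ≤ toℕ x
    1≤A* x x∈ = interval⇒1≤ (interval x x∈)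

    A*-antichain : Antichain n Astar
    A*-antichain x y x∈ y∈ x≢y x∣y with covered x x∈ | covered y y∈
    ... | t , t∈ , x∈t | t′ , t′∈ , y∈t′ =
      proj₁ (proj₂ (part-maximum t t∈)) x y x∈t (subst (λ s → y ∈ part s) (sym t≡t′) y∈t′) x≢y x∣y
      where
      t≡t′ : t ≡ t′
      t≡t′ = InL-base-unique t∈ t′∈
        (InL-multiple {t} (part-InL t∈ x∈t) (interval x x∈) (1≤A* y y∈) x∣y) (part-InL t′∈ y∈t′)

    1≤extend : ∀ x → x ∈ extend Astar → 1 ≤ toℕ x
    1≤extend x x∈ with ∈-extend⁻ Astar x∈
    ... | inj₁ x∈A*      = 1≤A* x x∈A*
    ... | inj₂ (n<x , _) = ≤-trans (s≤s z≤n) n<x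

    extend-antichain : Antichain n (extend Astar)
    extend-antichain x y x∈ y∈ x≢y x∣y with ∈-extend⁻ Astar x∈ | ∈-extend⁻ Astar y∈
    ... | inj₂ (n<x , _) | _                =
      x≢y (Fin.toℕ-injective (upper-divisor-≡ n<x (1≤extend y y∈) (≤2n y) x∣y))
    ... | inj₁ x∈A*      | inj₂ (_ , ¬w∣y) = ¬w∣y x x∈A* x∣y
    ... | inj₁ x∈A*      | inj₁ y∈A*       = A*-antichain x y x∈A* y∈A* x≢y x∣y

    extend-interval : InInterval n l p (extend Astar)
    extend-interval x x∈ with ∈-extend⁻ Astar x∈
    ... | inj₁ x∈A*      = interval x x∈A*
    ... | inj₂ (n<x , _) = <-≤-trans (*-monoʳ-< 2 n<x) (*-monoˡ-≤ (toℕ x) (<⇒≤ (2<q 1≤l)))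

    multiple-is-lifted : ∀ {w y} → w ∈ Astar → toℕ w ∣ toℕ y → n < toℕ y → ∃ λ x → x ∈ Astar × lift x ≡ y
    multiple-is-lifted {w} {y} w∈A* w∣y n<y with covered w w∈A*
    ... | t , t∈ , w∈t with hasPreimage? lift (part t) y
    ...   | yes (x , x∈t , lift-x≡y) = x , part⊆ t x t∈ x∈t , lift-x≡y
    ...   | no  y∉lift[t] = ⊥-elim (maximum⇒¬injection-missing {t} lift (part-maximum t t∈)
              (λ z z∈ → proj₁ (B-good z z∈)) (upper-antichain B (λ z z∈ → proj₂ (B-good z z∈)))
              (λ x x∈ → p⊆p∪q ⁅ y ⁆ (∈-image⁺ lift x∈))
              (λ x x′ x∈ x′∈ → lift-injective-on-antichain (proj₁ (proj₂ (part-maximum t t∈))) x x′ x∈ x′∈)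
              (q⊆p∪q (image lift (part t)) ⁅ y ⁆ (x∈⁅x⁆ y)) (λ x x∈ e → y∉lift[t] (x , x∈ , e)))
      where
      B = image lift (part t) ∪ ⁅ y ⁆
      B-good : ∀ z → z ∈ B → InL n l p t z × n < toℕ z
      B-good z z∈ with x∈p∪q⁻ (image lift (part t)) ⁅ y ⁆ z∈
      ... | inj₁ z∈lift[t] = let (x , x∈t , lift-x≡z) = ∈-image⁻ lift z∈lift[t] in
        subst (λ u → InL n l p t u × n < toℕ u) lift-x≡z
          (InL-lift {t} (part-InL t∈ x∈t) , lift-upper x (1≤A* x (part⊆ t x t∈ x∈t)))
      ... | inj₂ z∈y = subst (λ u → InL n l p t u × n < toℕ u) (sym (x∈⁅y⁆⇒x≡y y z∈y))
          (InL-multiple {t} (part-InL t∈ w∈t) (interval w w∈A*) (≤-trans (s≤s z≤n) n<y) w∣y , n<y)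

    lift-onto-upper : ∀ y → n < toℕ y → ∃ λ x → x ∈ extend Astar × lift x ≡ y
    lift-onto-upper y n<y with Fin.any? (λ w → (w ∈? Astar) ×-dec (toℕ w ∣? toℕ y))
    ... | yes (w , w∈A* , w∣y) = let (x , x∈A* , lift-x≡y) = multiple-is-lifted w∈A* w∣y n<y in
                                 x , p⊆p∪q _ x∈A* , lift-x≡y
    ... | no  ¬divisor          = y , free⇒∈extend Astar (n<y , λ w w∈ w∣y → ¬divisor (w , w∈ , w∣y)) ,
                                  lift-fixes-upper y n<y

    ∣extend∣≡n : ∣ extend Astar ∣ ≡ n
    ∣extend∣≡n = trans (≤-antisym ∣extend∣≤∣Upper∣ ∣Upper∣≤∣extend∣) ∣Upper∣≡n
      where
      ∣extend∣≤∣Upper∣ : ∣ extend Astar ∣ ≤ ∣ Upper ∣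
      ∣extend∣≤∣Upper∣ = injection⇒∣p∣≤∣q∣ (extend Astar) Upper (λ x _ → lift x)
        (λ x x∈ → ∈-select⁺ (λ x → n <? toℕ x) (lift-upper x (1≤extend x x∈)))
        (λ x y x∈ y∈ → lift-injective-on-antichain extend-antichain x y x∈ y∈)
      preimage : ∀ y → y ∈ Upper → ∃ λ x → x ∈ extend Astar × lift x ≡ y
      preimage y y∈ = lift-onto-upper y (∈-select⁻ (λ x → n <? toℕ x) y∈)
      lift-preimage : ∀ y y∈ → lift (proj₁ (preimage y y∈)) ≡ y
      lift-preimage y y∈ = proj₂ (proj₂ (preimage y y∈))
      ∣Upper∣≤∣extend∣ : ∣ Upper ∣ ≤ ∣ extend Astar ∣
      ∣Upper∣≤∣extend∣ = injection⇒∣p∣≤∣q∣ Upper (extend Astar) (λ y y∈ → proj₁ (preimage y y∈))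
        (λ y y∈ → proj₁ (proj₂ (preimage y y∈)))
        (λ y y′ y∈ y′∈ e → trans (sym (lift-preimage y y∈)) (trans (cong lift e) (lift-preimage y′ y′∈)))

    ¬free-InL : ∀ {t x} → t ∈ Tstar → InL n l p t x → ¬ Free Astar x
    ¬free-InL {t} {x} t∈ x∈L (n<x , ¬w∣x) = maximum⇒¬injection-missing {t} (λ z → z) (part-maximum t t∈)
      B⊆L B-antichain (λ z z∈ → p⊆p∪q ⁅ x ⁆ z∈) (λ _ _ _ _ e → e) (q⊆p∪q (part t) ⁅ x ⁆ (x∈⁅x⁆ x))
      (λ z z∈ z≡x → ¬w∣x z (part⊆ t z t∈ z∈) (∣-reflexive (cong toℕ z≡x)))
      where
      B = part t ∪ ⁅ x ⁆
      B⊆L : ∀ z → z ∈ B → InL n l p t z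
      B⊆L z z∈ with x∈p∪q⁻ (part t) ⁅ x ⁆ z∈
      ... | inj₁ z∈t = part-InL t∈ z∈t
      ... | inj₂ z∈x = subst (InL n l p t) (sym (x∈⁅y⁆⇒x≡y x z∈x)) x∈L
      B-antichain : Antichain n B
      B-antichain = antichain-∪-⁅⁆ {n} (proj₁ (proj₂ (part-maximum t t∈)))
        (λ w w∈ → ¬w∣x w (part⊆ t w t∈ w∈))
        (λ w w∈ x∣w → ¬w∣x w (part⊆ t w t∈ w∈) (∣-reflexive
          (sym (upper-divisor-≡ n<x (1≤A* w (part⊆ t w t∈ w∈)) (≤2n w) x∣w))))

  extend-reflects-⊆ : ∀ {A₁ A₂} → Admissible n l p Tstar A₁ → Admissible n l p Tstar A₂ →
    extend A₁ ≡ extend A₂ → A₁ ⊆ A₂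
  extend-reflects-⊆ {A₁} {A₂} adm₁ adm₂ e {x} x∈A₁ with ∈-extend⁻ A₂ (subst (x ∈_) e (p⊆p∪q _ x∈A₁))
  ... | inj₁ x∈A₂ = x∈A₂
  ... | inj₂ free with AdmissibleExtension.covered adm₁ x x∈A₁
  ...   | t , t∈ , x∈t =
    ⊥-elim (AdmissibleExtension.¬free-InL adm₂ t∈ (AdmissibleExtension.part-InL adm₁ t∈ x∈t) free)

claim2p1 : (n l : ℕ) → 1 ≤ n → 1 ≤ l →
    (p : Fin (suc l) → ℕ) → FirstPrimes l p →
    (Tstar : Subset (Univ n)) → (∀ t → t ∈ Tstar → InT n l p t) →
    Σ ((Astar : Subset (Univ n)) → Admissible n l p Tstar Astar → Subset (Univ n)) λ f →
      ((Astar : Subset (Univ n)) → (adm : Admissible n l p Tstar Astar) →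
        (∣ f Astar adm ∣ ≡ n) × Primitive n (f Astar adm) ×
        (Astar ⊆ f Astar adm) × InInterval n l p (f Astar adm)) ×
      ((A₁ A₂ : Subset (Univ n)) → (adm₁ : Admissible n l p Tstar A₁) →
        (adm₂ : Admissible n l p Tstar A₂) → f A₁ adm₁ ≡ f A₂ adm₂ → A₁ ≡ A₂)
claim2p1 n l _ 1≤l p firstPrimes Tstar Tstar⊆T =
  (λ Astar _ → extend Astar) ,
  (λ Astar adm → let open AdmissibleExtension adm in
    ∣extend∣≡n , extend-antichain , p⊆p∪q _ , extend-interval) ,
  (λ A₁ A₂ adm₁ adm₂ e → ⊆-antisym (extend-reflects-⊆ adm₁ adm₂ e) (extend-reflects-⊆ adm₂ adm₁ (sym e)))
  where open Extension n l 1≤l p firstPrimes Tstar Tstar⊆T
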